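{- Let $G$ be a simple undirected graph with $n$ vertices, let $\beta(G,n)$ be any coding sequence of $G$, and let $S=\{e_1,e_2,\ldots,e_k\}\subseteq\beta(G,n)$. Then $\tilde G(S)$ is a path in $G$ (i.e. the edges of $G$ corresponding to $e_1,\dots,e_k$ form a path) if and only if $\sum_{j=1}^k e_j\in C(n-1)$ and $S$ is reduced.
   Context: Coding sequences: for a simple graph $G=(V,E)$ with $n$ vertices, choose a labeling $V=\{v_0,\ldots,v_{n-1}\}$. For an edge $e=v_iv_j$ with $i>j$ let $f^\#(e)=(x_1,\ldots,x_{n-1})\in\mathbb{Z}_2^{n-1}$ with $x_k=1$ iff $n-i\le k\le n-j-1$ and $x_k=0$ otherwise; $\beta(G,n)=\{f^\#(e):e\in E\}$. $C(n-1)$ is the set of non-zero vectors in $\mathbb{Z}_2^{n-1}$ whose $1$'s occupy consecutive coordinates. For $S\subseteq C(n-1)$, $G(S)$ is the graph on vertex set $\{0,\ldots,n-1\}$ where each $e\in S$ with $1$'s from the $i$-th to the $j$-th coordinate (from the left) is an edge joining vertices $n-i$ and $n-j-1$, and $\tilde G(S)$ is $G(S)$ with isolated vertices removed (for $S\subseteq\beta(G,n)$ this is the subgraph of $G$ formed by the edges corresponding to $S$). A non-empty set $S$ of non-zero vectors is reduced if $\sum_{e\in A}e\neq\mathbf{0}$ for every non-empty proper subset $A\subsetneq S$. -}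

module Defs where

open import Data.Nat using (ℕ; zero; suc; pred; _∸_; _≤_; _<_; _≤ᵇ_)
open import Data.Bool using (Bool; true; false; _∧_; _xor_)
open import Data.Fin using (Fin; toℕ)
open import Data.Vec using (Vec; tabulate; zipWith; replicate; lookup)
open import Data.List using (List; []; _∷_; foldr; length)
open import Data.List.Membership.Propositional using (_∈_)
open import Data.List.Relation.Unary.Unique.Propositional using (Unique)
open import Data.List.Relation.Binary.Sublist.Propositional using (_⊆_)
open import Data.Product using (Σ; ∃; ∃-syntax; _×_; _,_)
open import Data.Sum using (_⊎_)
open import Relation.Nullary using (¬_)
open import Relation.Binary.PropositionalEquality using (_≡_; _≢_)
open import Function.Bundles using (_⇔_)

record SimpleGraph (n : ℕ) : Set₁ where
  field
    Adj    : Fin n → Fin n → Set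
    sym    : ∀ {u v} → Adj u v → Adj v u
    irrefl : ∀ {u} → ¬ Adj u u

-- Z_2^m as Vec Bool m; coordinate k (1-indexed) of x is  lookup x (k-1)

Z2 : ℕ → Set
Z2 m = Vec Bool m

_⊕_ : ∀ {m} → Z2 m → Z2 m → Z2 m
_⊕_ = zipWith _xor_

𝟎 : ∀ {m} → Z2 m
𝟎 = replicate _ false

sumZ2 : ∀ {m} → List (Z2 m) → Z2 m
sumZ2 = foldr _⊕_ 𝟎

-- vector with 1's exactly at coordinates i,…,j (1-indexed)
block : (m i j : ℕ) → Z2 m
block m i j = tabulate λ (k : Fin m) → (i ≤ᵇ suc (toℕ k)) ∧ (suc (toℕ k) ≤ᵇ j)

-- f^#(v_i v_j) for i > j: x_k = 1 iff n-i ≤ k ≤ n-j-1, in Z_2^(n-1)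
code : (n i j : ℕ) → Z2 (pred n)
code n i j = block (pred n) (n ∸ i) (n ∸ j ∸ 1)

-- membership in the coding sequence β(G,n) = { f^#(e) : e ∈ E }
InBeta : ∀ {n} → SimpleGraph n → Z2 (pred n) → Set
InBeta {n} G x =
  ∃[ i ] ∃[ j ] (toℕ j < toℕ i × SimpleGraph.Adj G i j × x ≡ code n (toℕ i) (toℕ j))

InC : ∀ {m} → Z2 m → Set
InC {m} x =
  x ≢ 𝟎 ×
  (∀ (a b c : Fin m) → toℕ a ≤ toℕ b → toℕ b ≤ toℕ c →
     lookup x a ≡ true → lookup x c ≡ true → lookup x b ≡ true)

-- S (a duplicate-free list) is reduced: non-empty, and every non-empty proper
-- subset (= sublist, as S has no duplicates) has non-zero sum
Reduced : ∀ {m} → List (Z2 m) → Set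
Reduced {m} S =
  S ≢ [] ×
  (∀ (A : List (Z2 m)) → A ⊆ S → A ≢ [] → length A < length S → sumZ2 A ≢ 𝟎)

-- The graph G(S) on vertex set {0,…,n-1}: a vector e ∈ S with 1's from the
-- i-th to the j-th coordinate is an edge joining n-i and n-j-1.

GSAdj : (n : ℕ) → List (Z2 (pred n)) → ℕ → ℕ → Set
GSAdj n S u w =
  ∃[ i ] ∃[ j ] (1 ≤ i × i ≤ j × j ≤ pred n × block (pred n) i j ∈ S ×
    ((u ≡ n ∸ i × w ≡ n ∸ j ∸ 1) ⊎ (w ≡ n ∸ i × u ≡ n ∸ j ∸ 1)))

data Consec : List ℕ → ℕ → ℕ → Set where
  here  : ∀ {u w rest} → Consec (u ∷ w ∷ rest) u w
  there : ∀ {x vs u w} → Consec vs u w → Consec (x ∷ vs) u w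

-- G̃(S) (G(S) without isolated vertices) is a path: there is a sequence of
-- at least two pairwise distinct vertices u_0,…,u_k such that the edges of
-- G(S) are exactly the pairs u_t u_{t+1}.
IsPathGS : (n : ℕ) → List (Z2 (pred n)) → Set
IsPathGS n S =
  ∃[ vs ] (2 ≤ length vs × Unique vs ×
    (∀ u w → GSAdj n S u w ⇔ (Consec vs u w ⊎ Consec vs w u)))

module Submission where

-- Write n = m+1.  Give the vertex v the potential  pot v ∈ Z₂^m, whose 1's
-- are the last v coordinates; the code of the edge uw is pot u ⊕ pot w, a
-- block of consecutive 1's, and C(m) consists exactly of these edge vectors.
-- Reading the discrete derivative of a vector at vertex v gives a linear map
-- ∂ v with ∂ v (edge u w) = [u = v] xor [w = v]: it counts degrees mod 2.
-- ⇒: the edges of a path a ⇝ b telescope to pot a ⊕ pot b ∈ C(m), and a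
--    non-empty set of path edges has odd degree at its vertex nearest to a.
-- ⇐: ΣS = edge p q; by parity some edge pr of S leaves p; by induction the
--    rest of S is a path r ⇝ q, which avoids p because otherwise its part
--    from r to p would close a cycle, a zero-sum proper part of S.

open import Defs
open import Algebra.Bundles using (CommutativeRing)
open import Algebra.Structures using (IsCommutativeMonoid)
open import Algebra.Structures.Biased using (isCommutativeMonoidˡ)
import Algebra.Properties.CommutativeSemigroup as CommSemigroupProperties
open import Data.Bool using (Bool; true; false; _∧_; _xor_)
open import Data.Bool.Properties
  using (∧-identityʳ; xor-assoc; xor-comm; xor-same; xor-identityˡ; xor-identityʳ; xor-∧-commutativeRing)
  renaming (_≟_ to _≟ᴮ_)
open import Data.Empty using (⊥; ⊥-elim)
open import Data.Fin using (Fin; toℕ; fromℕ<) renaming (zero to fzero; suc to fsuc)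
open import Data.Fin.Properties using (toℕ-fromℕ<; toℕ<n)
open import Data.List using (List; []; _∷_; length; filter; _++_; [_])
open import Data.List.Properties using (filter-notAll)
open import Data.List.Membership.Propositional using (_∈_; _∉_)
open import Data.List.Membership.Propositional.Properties using (∈-filter⁺; ∈-filter⁻; ∈-++⁺ʳ; ∈-∃++)
open import Data.List.Membership.Propositional.Properties.WithK using (unique∧set⇒bag)
import Data.List.Membership.DecPropositional as DecMembership
open import Data.List.Relation.Binary.BagAndSetEquality using (_∼[_]_; set; ∼bag⇒↭)
open import Data.List.Relation.Binary.Permutation.Propositional using (↭⇒↭ₛ)
import Data.List.Relation.Binary.Permutation.Setoid.Properties as PermutationProperties
open import Data.List.Relation.Binary.Sublist.Propositional using (_⊆_; []; _∷_; _∷ʳ_; ⊆-refl)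
open import Data.List.Relation.Binary.Sublist.Propositional.Properties
  using (All-resp-⊆; Any-resp-⊆; ++⁺ʳ; filter-⊆)
open import Data.List.Relation.Unary.All as All using (All; []; _∷_)
open import Data.List.Relation.Unary.Any as Any using (Any; here; there)
open import Data.List.Relation.Unary.Unique.Propositional using (Unique; []; _∷_)
open import Data.List.Relation.Unary.Unique.Propositional.Properties using (filter⁺; Unique[x∷xs]⇒x∉xs)
open import Data.Nat using (ℕ; zero; suc; pred; _∸_; _≤_; _<_; _≤ᵇ_; _≡ᵇ_; z≤n; s≤s; _≤?_)
open import Data.Nat.Induction using (<-wellFounded)
open import Data.Nat.Properties
  using ( _≟_; ≤ᵇ-reflects-≤; +-comm; ∸-+-assoc; +-∸-assoc; ∸-monoʳ-<; n≤1+n; <-cmp; ≤-refl; ≤-trans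
        ; ≤-<-trans; <⇒≤; <⇒≱; ≰⇒>; <⇒≢; ≤-pred; m∸n≤m; m∸[m∸n]≡n; ∸-cancelˡ-≡)
open import Data.Product using (∃; ∃-syntax; _×_; _,_; proj₁; proj₂)
open import Data.Sum using (_⊎_; inj₁; inj₂) renaming (swap to ⊎-swap)
open import Data.Vec using ([]; _∷_; tabulate; lookup; zipWith)
open import Data.Vec.Properties using (zipWith-comm; zipWith-assoc; zipWith-identityˡ; tabulate-cong; ≡-dec)
open import Function using (_∘_; _on_)
open import Function.Bundles using (_⇔_; mk⇔; Equivalence)
open import Function.Properties.Equivalence using () renaming (trans to ⇔-trans; sym to ⇔-sym)
open import Induction.WellFounded using (Acc; acc)
import Relation.Binary.Construct.On as On
open import Relation.Binary.Definitions using (tri<; tri≈; tri>)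
open import Relation.Binary.PropositionalEquality
  using (_≡_; _≢_; refl; sym; trans; cong; cong₂; subst; subst₂; isEquivalence; setoid; module ≡-Reasoning)
open import Relation.Nullary using (¬_; Dec; yes; no; ¬?; contradiction)
open import Relation.Nullary.Decidable using (proof)
open import Relation.Nullary.Reflects using (Reflects; ofʸ; ofⁿ; det)

open CommSemigroupProperties (CommutativeRing.+-commutativeSemigroup xor-∧-commutativeRing)
  using () renaming (interchange to xor-interchange)

xor-cancel : ∀ a b t → (a xor t) xor (b xor t) ≡ a xor b
xor-cancel a b t = begin
  (a xor t) xor (b xor t)  ≡⟨ xor-interchange a t b t ⟩
  (a xor b) xor (t xor t)  ≡⟨ cong ((a xor b) xor_) (xor-same t) ⟩
  (a xor b) xor false      ≡⟨ xor-identityʳ (a xor b) ⟩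
  a xor b                  ∎
  where open ≡-Reasoning

≤ᵇ-true : ∀ {a b} → a ≤ b → (a ≤ᵇ b) ≡ true
≤ᵇ-true {a} {b} a≤b = det (≤ᵇ-reflects-≤ a b) (ofʸ a≤b)

≤ᵇ-false : ∀ {a b} → ¬ a ≤ b → (a ≤ᵇ b) ≡ false
≤ᵇ-false {a} {b} a≰b = det (≤ᵇ-reflects-≤ a b) (ofⁿ a≰b)

-- ≤ᵇ commutes with successors (the builtin only computes this on numerals)
suc-≤ᵇ : ∀ a b → (suc a ≤ᵇ suc b) ≡ (a ≤ᵇ b)
suc-≤ᵇ zero    b = refl
suc-≤ᵇ (suc a) b = refl

≡ᵇ-reflects : ∀ a b → Reflects (a ≡ b) (a ≡ᵇ b)
≡ᵇ-reflects a b = proof (a ≟ b)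

≡ᵇ-true : ∀ {a b} → a ≡ b → (a ≡ᵇ b) ≡ true
≡ᵇ-true {a} {b} a≡b = det (≡ᵇ-reflects a b) (ofʸ a≡b)

≡ᵇ-false : ∀ {a b} → a ≢ b → (a ≡ᵇ b) ≡ false
≡ᵇ-false {a} {b} a≢b = det (≡ᵇ-reflects a b) (ofⁿ a≢b)

⊕-self : ∀ {m} (x : Z2 m) → x ⊕ x ≡ 𝟎
⊕-self []      = refl
⊕-self (b ∷ x) = cong₂ _∷_ (xor-same b) (⊕-self x)

module _ {m : ℕ} where

  ⊕-comm : (x y : Z2 m) → x ⊕ y ≡ y ⊕ x
  ⊕-comm = zipWith-comm xor-comm

  ⊕-assoc : (x y z : Z2 m) → (x ⊕ y) ⊕ z ≡ x ⊕ (y ⊕ z)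
  ⊕-assoc = zipWith-assoc xor-assoc

  ⊕-identityˡ : (x : Z2 m) → 𝟎 ⊕ x ≡ x
  ⊕-identityˡ = zipWith-identityˡ xor-identityˡ

  ⊕-isCommutativeMonoid : IsCommutativeMonoid _≡_ _⊕_ 𝟎
  ⊕-isCommutativeMonoid = isCommutativeMonoidˡ record
    { isSemigroup = record
      { isMagma = record { isEquivalence = isEquivalence ; ∙-cong = cong₂ _⊕_ }
      ; assoc   = ⊕-assoc }
    ; identityˡ = ⊕-identityˡ
    ; comm      = ⊕-comm }

  ⊕-cancelˡ : (x y : Z2 m) → x ⊕ (x ⊕ y) ≡ y
  ⊕-cancelˡ x y = begin
    x ⊕ (x ⊕ y)  ≡⟨ sym (⊕-assoc x x y) ⟩
    (x ⊕ x) ⊕ y  ≡⟨ cong (_⊕ y) (⊕-self x) ⟩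
    𝟎 ⊕ y        ≡⟨ ⊕-identityˡ y ⟩
    y            ∎
    where open ≡-Reasoning

  ⊕-telescope : (x y z : Z2 m) → (x ⊕ y) ⊕ (y ⊕ z) ≡ x ⊕ z
  ⊕-telescope x y z = begin
    (x ⊕ y) ⊕ (y ⊕ z)  ≡⟨ ⊕-assoc x y (y ⊕ z) ⟩
    x ⊕ (y ⊕ (y ⊕ z))  ≡⟨ cong (x ⊕_) (⊕-cancelˡ y z) ⟩
    x ⊕ z              ∎
    where open ≡-Reasoning

  ⊕≡𝟎⇒≡ : (x y : Z2 m) → x ⊕ y ≡ 𝟎 → x ≡ y
  ⊕≡𝟎⇒≡ x y x⊕y≡𝟎 = begin
    x              ≡⟨ sym (⊕-cancelˡ y x) ⟩
    y ⊕ (y ⊕ x)    ≡⟨ cong (y ⊕_) (trans (⊕-comm y x) x⊕y≡𝟎) ⟩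
    y ⊕ 𝟎          ≡⟨ ⊕-comm y 𝟎 ⟩
    𝟎 ⊕ y          ≡⟨ ⊕-identityˡ y ⟩
    y              ∎
    where open ≡-Reasoning

  _≟ᵥ_ : (x y : Z2 m) → Dec (x ≡ y)
  _≟ᵥ_ = ≡-dec _≟ᴮ_

module _ {m : ℕ} where

  open PermutationProperties (setoid (Z2 m)) using (foldr-commMonoid)

  sum-set : {xs ys : List (Z2 m)} → Unique xs → Unique ys → xs ∼[ set ] ys → sumZ2 xs ≡ sumZ2 ys
  sum-set uxs uys xs≈ys =
    foldr-commMonoid ⊕-isCommutativeMonoid (↭⇒↭ₛ (∼bag⇒↭ (unique∧set⇒bag uxs uys xs≈ys)))

  remove : Z2 m → List (Z2 m) → List (Z2 m)
  remove x = filter (λ y → ¬? (y ≟ᵥ x))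

  ∈-remove⁺ : ∀ {x z S} → z ∈ S → z ≢ x → z ∈ remove x S
  ∈-remove⁺ {x} = ∈-filter⁺ (λ y → ¬? (y ≟ᵥ x))

  ∈-remove⁻ : ∀ {x z} S → z ∈ remove x S → z ∈ S × z ≢ x
  ∈-remove⁻ {x} S = ∈-filter⁻ (λ y → ¬? (y ≟ᵥ x)) {xs = S}

  remove-unique : ∀ {x S} → Unique S → Unique (remove x S)
  remove-unique {x} = filter⁺ (λ y → ¬? (y ≟ᵥ x))

  sum-remove : ∀ {x S} → Unique S → x ∈ S → sumZ2 S ≡ x ⊕ sumZ2 (remove x S)
  sum-remove {x} {S} uS x∈S = sum-set uS (x∉ ∷ remove-unique uS) (mk⇔ split merge)
    where
    x∉ : All (x ≢_) (remove x S)
    x∉ = All.tabulate λ z∈ x≡z → proj₂ (∈-remove⁻ S z∈) (sym x≡z)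
    split : ∀ {z} → z ∈ S → z ∈ x ∷ remove x S
    split {z} z∈S with z ≟ᵥ x
    ... | yes refl = here refl
    ... | no z≢x   = there (∈-remove⁺ z∈S z≢x)
    merge : ∀ {z} → z ∈ x ∷ remove x S → z ∈ S
    merge (here refl) = x∈S
    merge (there z∈)  = proj₁ (∈-remove⁻ S z∈)

-- Coordinates are read as a Boolean sequence indexed by ℕ (0-indexed,
-- zero beyond the length).

coord : ∀ {m} → Z2 m → ℕ → Bool
coord []      _       = false
coord (b ∷ x) zero    = b
coord (b ∷ x) (suc k) = coord x k

coord-⊕ : ∀ {m} (x y : Z2 m) k → coord (x ⊕ y) k ≡ coord x k xor coord y k
coord-⊕ []      []      k       = refl
coord-⊕ (a ∷ x) (b ∷ y) zero    = refl
coord-⊕ (a ∷ x) (b ∷ y) (suc k) = coord-⊕ x y k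

coord-𝟎 : ∀ m k → coord (𝟎 {m}) k ≡ false
coord-𝟎 zero    k       = refl
coord-𝟎 (suc m) zero    = refl
coord-𝟎 (suc m) (suc k) = coord-𝟎 m k

coord-lookup : ∀ {m} (x : Z2 m) (i : Fin m) → coord x (toℕ i) ≡ lookup x i
coord-lookup (b ∷ x) fzero    = refl
coord-lookup (b ∷ x) (fsuc i) = coord-lookup x i

coord-beyond : ∀ {m} (x : Z2 m) k → m ≤ k → coord x k ≡ false
coord-beyond []      k       _         = refl
coord-beyond (b ∷ x) (suc k) (s≤s m≤k) = coord-beyond x k m≤k

step : ∀ {m} → ℕ → Z2 m
step c = tabulate λ k → c ≤ᵇ toℕ k

step-suc : ∀ {m} c → step {suc m} (suc c) ≡ false ∷ step {m} c
step-suc c = cong (false ∷_) (tabulate-cong λ k → suc-≤ᵇ c (toℕ k))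

-- inside the vector, step c is the indicator of [c, ∞); the term m ≤ᵇ k
-- cuts it off at the length m
coord-step : ∀ {m} c k → c ≤ m → coord (step {m} c) k ≡ (c ≤ᵇ k) xor (m ≤ᵇ k)
coord-step {zero}  zero    k       z≤n = refl
coord-step {suc m} zero    zero    _   = refl
coord-step {suc m} zero    (suc k) _   rewrite suc-≤ᵇ m k = coord-step {m} zero k z≤n
coord-step {suc m} (suc c) zero    _   = refl
coord-step {suc m} (suc c) (suc k) (s≤s c≤m) = begin
  coord (step {suc m} (suc c)) (suc k)       ≡⟨ cong (λ v → coord v (suc k)) (step-suc {m} c) ⟩
  coord (step {m} c) k                       ≡⟨ coord-step c k c≤m ⟩
  (c ≤ᵇ k) xor (m ≤ᵇ k)                      ≡⟨ sym (cong₂ _xor_ (suc-≤ᵇ c k) (suc-≤ᵇ m k)) ⟩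
  (suc c ≤ᵇ suc k) xor (suc m ≤ᵇ suc k)      ∎
  where open ≡-Reasoning

coord-steps : ∀ {m} c d k → c ≤ m → d ≤ m →
              coord (step {m} c ⊕ step d) k ≡ (c ≤ᵇ k) xor (d ≤ᵇ k)
coord-steps {m} c d k c≤m d≤m = begin
  coord (step {m} c ⊕ step d) k                ≡⟨ coord-⊕ (step {m} c) (step d) k ⟩
  coord (step {m} c) k xor coord (step {m} d) k  ≡⟨ cong₂ _xor_ (coord-step c k c≤m) (coord-step d k d≤m) ⟩
  ((c ≤ᵇ k) xor (m ≤ᵇ k)) xor ((d ≤ᵇ k) xor (m ≤ᵇ k))  ≡⟨ xor-cancel (c ≤ᵇ k) (d ≤ᵇ k) (m ≤ᵇ k) ⟩
  (c ≤ᵇ k) xor (d ≤ᵇ k)                        ∎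
  where open ≡-Reasoning

-- discrete derivative of a Boolean sequence (with f(-1) read as false)
Δ : (ℕ → Bool) → ℕ → Bool
Δ f zero    = f zero
Δ f (suc c) = f (suc c) xor f c

Δ-cong : ∀ {f g : ℕ → Bool} → (∀ k → f k ≡ g k) → ∀ c → Δ f c ≡ Δ g c
Δ-cong f≗g zero    = f≗g zero
Δ-cong f≗g (suc c) = cong₂ _xor_ (f≗g (suc c)) (f≗g c)

Δ-xor : ∀ (f g : ℕ → Bool) c → Δ (λ k → f k xor g k) c ≡ Δ f c xor Δ g c
Δ-xor f g zero    = refl
Δ-xor f g (suc c) = xor-interchange (f (suc c)) (g (suc c)) (f c) (g c)

≤ᵇ-jump : ∀ d c → (d ≤ᵇ c) xor (suc d ≤ᵇ c) ≡ (d ≡ᵇ c)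
≤ᵇ-jump zero    zero    = refl
≤ᵇ-jump zero    (suc c) = refl
≤ᵇ-jump (suc d) zero    = refl
≤ᵇ-jump (suc d) (suc c) rewrite suc-≤ᵇ d c = ≤ᵇ-jump d c

Δ-≤ᵇ : ∀ d c → Δ (d ≤ᵇ_) c ≡ (d ≡ᵇ c)
Δ-≤ᵇ zero    zero    = refl
Δ-≤ᵇ zero    (suc c) = refl
Δ-≤ᵇ (suc d) zero    = refl
Δ-≤ᵇ (suc d) (suc c) rewrite suc-≤ᵇ d c = ≤ᵇ-jump d c

Δ-step : ∀ {m} c d → c ≤ m → Δ (coord (step {m} c)) d ≡ (c ≡ᵇ d) xor (m ≡ᵇ d)
Δ-step {m} c d c≤m = begin
  Δ (coord (step {m} c)) d                    ≡⟨ Δ-cong (λ k → coord-step {m} c k c≤m) d ⟩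
  Δ (λ k → (c ≤ᵇ k) xor (m ≤ᵇ k)) d           ≡⟨ Δ-xor (c ≤ᵇ_) (m ≤ᵇ_) d ⟩
  Δ (c ≤ᵇ_) d xor Δ (m ≤ᵇ_) d                 ≡⟨ cong₂ _xor_ (Δ-≤ᵇ c d) (Δ-≤ᵇ m d) ⟩
  (c ≡ᵇ d) xor (m ≡ᵇ d)                       ∎
  where open ≡-Reasoning

Δ-⊕ : ∀ {m} (x y : Z2 m) c → Δ (coord (x ⊕ y)) c ≡ Δ (coord x) c xor Δ (coord y) c
Δ-⊕ x y c = trans (Δ-cong (coord-⊕ x y) c) (Δ-xor (coord x) (coord y) c)

Δ-𝟎 : ∀ {m} c → Δ (coord (𝟎 {m})) c ≡ false
Δ-𝟎 {m} c = trans (Δ-cong (coord-𝟎 m) c) (Δ-const c)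
  where
  Δ-const : ∀ c → Δ (λ _ → false) c ≡ false
  Δ-const zero    = refl
  Δ-const (suc c) = refl

-- C(m) consists of the non-zero sums of two step vectors: a block of
-- consecutive 1's is where two steps differ.

Convex : ∀ {m} → Z2 m → Set
Convex x = ∀ a b c → a ≤ b → b ≤ c → coord x a ≡ true → coord x c ≡ true → coord x b ≡ true

InC⇒Convex : ∀ {m} {x : Z2 m} → InC x → Convex x
InC⇒Convex {m} {x} (_ , convex) a b c a≤b b≤c xa≡true xc≡true with m ≤? c
... | yes m≤c = contradiction (trans (sym xc≡true) (coord-beyond x c m≤c)) λ ()
... | no m≰c  = begin
  coord x b                      ≡⟨ at b<m ⟩
  lookup x (fromℕ< b<m)          ≡⟨ convex (fromℕ< a<m) (fromℕ< b<m) (fromℕ< c<m)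
                                      (subst₂ _≤_ (sym (toℕ-fromℕ< a<m)) (sym (toℕ-fromℕ< b<m)) a≤b)
                                      (subst₂ _≤_ (sym (toℕ-fromℕ< b<m)) (sym (toℕ-fromℕ< c<m)) b≤c)
                                      (trans (sym (at a<m)) xa≡true) (trans (sym (at c<m)) xc≡true) ⟩
  true                           ∎
  where
  open ≡-Reasoning
  c<m : c < m
  c<m = ≰⇒> m≰c
  b<m : b < m
  b<m = ≤-<-trans b≤c c<m
  a<m : a < m
  a<m = ≤-<-trans a≤b b<m
  at : ∀ {t} (t<m : t < m) → coord x t ≡ lookup x (fromℕ< t<m)
  at t<m = trans (cong (coord x) (sym (toℕ-fromℕ< t<m))) (coord-lookup x (fromℕ< t<m))

convex-tail : ∀ {m b} {x : Z2 m} → Convex (b ∷ x) → Convex x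
convex-tail convex a b c a≤b b≤c = convex (suc a) (suc b) (suc c) (s≤s a≤b) (s≤s b≤c)

-- a non-zero vector with convex support is the sum of two step vectors; by
-- induction: a leading 0 shifts both steps, a leading 1 forces the block to
-- start at position 0
convex⇒steps : ∀ {m} (x : Z2 m) → Convex x → x ≢ 𝟎 →
               ∃[ c ] ∃[ d ] (c < d × d ≤ m × x ≡ step c ⊕ step d)
convex⇒steps []          _      x≢𝟎 = contradiction refl x≢𝟎
convex⇒steps (false ∷ x) convex x≢𝟎
  with convex⇒steps x (convex-tail convex) (x≢𝟎 ∘ cong (false ∷_))
... | c , d , c<d , d≤m , x≡ =
  suc c , suc d , s≤s c<d , s≤s d≤m ,
  trans (cong (false ∷_) x≡) (sym (cong₂ _⊕_ (step-suc c) (step-suc d)))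
convex⇒steps {suc m} (true ∷ x) convex _ with x ≟ᵥ 𝟎
... | yes refl = 0 , 1 , s≤s z≤n , s≤s z≤n , cong (true ∷_) (sym (⊕-self (step 0)))
... | no x≢𝟎 with convex⇒steps x (convex-tail convex) x≢𝟎
...   | zero , d , _ , d≤m , x≡ =
  0 , suc d , s≤s z≤n , s≤s d≤m ,
  trans (cong (true ∷_) x≡) (sym (cong (step 0 ⊕_) (step-suc d)))
...   | suc c , d , c<d@(s≤s (s≤s _)) , d≤m@(s≤s _) , refl = contradiction gap λ ()
  where
  -- a 1 at position 0 and at position c+2 of  true ∷ x, but a 0 at position 1
  gap : false ≡ true
  gap = begin
    false                                ≡⟨⟩
    coord (step {m} (suc c) ⊕ step d) 0  ≡⟨ convex 0 1 (suc (suc c)) z≤n (s≤s z≤n) refl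
                                              (trans (coord-steps (suc c) d (suc c) (<⇒≤ (≤-trans c<d d≤m)) d≤m)
                                                 (cong₂ _xor_ (≤ᵇ-true (≤-refl {suc c})) (≤ᵇ-false (<⇒≱ c<d)))) ⟩
    true                                 ∎
    where open ≡-Reasoning

-- the sum of two step vectors has convex support: a position is in the
-- support iff it has passed exactly one of the two steps
steps-convex : ∀ {m} c d → c ≤ m → d ≤ m → Convex (step {m} c ⊕ step d)
steps-convex c d c≤m d≤m t₁ t₂ t₃ t₁≤t₂ t₂≤t₃ in₁ in₃
  rewrite coord-steps c d t₁ c≤m d≤m | coord-steps c d t₂ c≤m d≤m | coord-steps c d t₃ c≤m d≤m
  with c ≤? t₂ | d ≤? t₂
... | yes c≤t₂ | yes d≤t₂
  rewrite ≤ᵇ-true (≤-trans c≤t₂ t₂≤t₃) | ≤ᵇ-true (≤-trans d≤t₂ t₂≤t₃) = contradiction in₃ λ ()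
... | no c≰t₂  | no d≰t₂
  rewrite ≤ᵇ-false (c≰t₂ ∘ λ c≤t₁ → ≤-trans c≤t₁ t₁≤t₂) | ≤ᵇ-false (d≰t₂ ∘ λ d≤t₁ → ≤-trans d≤t₁ t₁≤t₂) = contradiction in₁ λ ()
... | yes c≤t₂ | no d≰t₂ rewrite ≤ᵇ-true c≤t₂ | ≤ᵇ-false d≰t₂ = refl
... | no c≰t₂  | yes d≤t₂ rewrite ≤ᵇ-false c≰t₂ | ≤ᵇ-true d≤t₂ = refl

InC⇒steps : ∀ {m} {x : Z2 m} → InC x → ∃[ c ] ∃[ d ] (c < d × d ≤ m × x ≡ step c ⊕ step d)
InC⇒steps {x = x} inC = convex⇒steps x (InC⇒Convex inC) (proj₁ inC)

steps⇒InC : ∀ {m} c d → c ≤ m → d ≤ m → step {m} c ⊕ step d ≢ 𝟎 → InC (step {m} c ⊕ step d)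
steps⇒InC {m} c d c≤m d≤m nonzero = nonzero , convex
  where
  x : Z2 m
  x = step {m} c ⊕ step d
  convex : ∀ (a b k : Fin m) → toℕ a ≤ toℕ b → toℕ b ≤ toℕ k →
           lookup x a ≡ true → lookup x k ≡ true → lookup x b ≡ true
  convex a b k a≤b b≤k xa xk =
    trans (sym (coord-lookup x b))
      (steps-convex c d c≤m d≤m (toℕ a) (toℕ b) (toℕ k) a≤b b≤k
        (trans (coord-lookup x a) xa) (trans (coord-lookup x k) xk))

-- For a graph on the vertices 0,…,m the vertex v gets the potential
-- pot v = step (m ∸ v), and the edge uw is coded by pot u ⊕ pot w (the
-- block of 1's between the two steps).  Reading the derivative of a vector
-- at position m ∸ v gives its boundary ∂ v at the vertex v: the boundary of
-- an edge is its pair of endpoints.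

module _ {m : ℕ} where

  pot : ℕ → Z2 m
  pot v = step (m ∸ v)

  edge : ℕ → ℕ → Z2 m
  edge u w = pot u ⊕ pot w

  edge-comm : ∀ u w → edge u w ≡ edge w u
  edge-comm u w = ⊕-comm (pot u) (pot w)

  ∂ : ℕ → Z2 m → Bool
  ∂ v x = Δ (coord x) (m ∸ v)

  ∂-⊕ : ∀ v (x y : Z2 m) → ∂ v (x ⊕ y) ≡ ∂ v x xor ∂ v y
  ∂-⊕ v x y = Δ-⊕ x y (m ∸ v)

  ∂-𝟎 : ∀ v → ∂ v 𝟎 ≡ false
  ∂-𝟎 v = Δ-𝟎 {m} (m ∸ v)

  ∸-≡ᵇ : ∀ {u v} → u ≤ m → v ≤ m → ((m ∸ u) ≡ᵇ (m ∸ v)) ≡ (u ≡ᵇ v)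
  ∸-≡ᵇ {u} {v} u≤m v≤m with u ≟ v
  ... | yes refl = trans (≡ᵇ-true {m ∸ u} refl) (sym (≡ᵇ-true {u} refl))
  ... | no u≢v   = trans (≡ᵇ-false (u≢v ∘ ∸-cancelˡ-≡ u≤m v≤m)) (sym (≡ᵇ-false u≢v))

  -- a potential has boundary at its own vertex and at the vertex 0
  ∂-pot : ∀ {u v} → u ≤ m → v ≤ m → ∂ v (pot u) ≡ (u ≡ᵇ v) xor (m ≡ᵇ (m ∸ v))
  ∂-pot {u} {v} u≤m v≤m =
    trans (Δ-step (m ∸ u) (m ∸ v) (m∸n≤m m u)) (cong (_xor (m ≡ᵇ (m ∸ v))) (∸-≡ᵇ u≤m v≤m))

  ∂-edge : ∀ {u w v} → u ≤ m → w ≤ m → v ≤ m → ∂ v (edge u w) ≡ (u ≡ᵇ v) xor (w ≡ᵇ v)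
  ∂-edge {u} {w} {v} u≤m w≤m v≤m = begin
    ∂ v (edge u w)                                            ≡⟨ ∂-⊕ v (pot u) (pot w) ⟩
    ∂ v (pot u) xor ∂ v (pot w)                               ≡⟨ cong₂ _xor_ (∂-pot u≤m v≤m) (∂-pot w≤m v≤m) ⟩
    ((u ≡ᵇ v) xor (m ≡ᵇ (m ∸ v))) xor ((w ≡ᵇ v) xor (m ≡ᵇ (m ∸ v)))
                                                              ≡⟨ xor-cancel (u ≡ᵇ v) (w ≡ᵇ v) (m ≡ᵇ (m ∸ v)) ⟩
    (u ≡ᵇ v) xor (w ≡ᵇ v)                                     ∎
    where open ≡-Reasoning

  ∂-edge-end : ∀ {u w} → u ≤ m → w ≤ m → u ≢ w → ∂ u (edge u w) ≡ true
  ∂-edge-end {u} {w} u≤m w≤m u≢w =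
    trans (∂-edge u≤m w≤m u≤m) (cong₂ _xor_ (≡ᵇ-true {u} refl) (≡ᵇ-false (u≢w ∘ sym)))

  ∂-edge-away : ∀ {c d v} → c ≤ m → d ≤ m → v ≤ m → c ≢ v → d ≢ v → ∂ v (edge c d) ≡ false
  ∂-edge-away c≤m d≤m v≤m c≢v d≢v =
    trans (∂-edge c≤m d≤m v≤m) (cong₂ _xor_ (≡ᵇ-false c≢v) (≡ᵇ-false d≢v))

  ∂-edge-endpoint : ∀ {u w v} → u ≤ m → w ≤ m → v ≤ m → ∂ v (edge u w) ≡ true → u ≡ v ⊎ w ≡ v
  ∂-edge-endpoint {u} {w} {v} u≤m w≤m v≤m ∂≡true with u ≟ v | w ≟ v
  ... | yes u≡v | _       = inj₁ u≡v
  ... | no _    | yes w≡v = inj₂ w≡v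
  ... | no u≢v  | no w≢v  = contradiction (trans (sym ∂≡true) (∂-edge-away u≤m w≤m v≤m u≢v w≢v)) λ ()

  edge-nonzero : ∀ {u w} → u ≤ m → w ≤ m → u ≢ w → edge u w ≢ 𝟎
  edge-nonzero {u} u≤m w≤m u≢w edge≡𝟎 =
    contradiction (trans (sym (∂-edge-end u≤m w≤m u≢w)) (trans (cong (∂ u) edge≡𝟎) (∂-𝟎 u))) λ ()

  pot-injective : ∀ {u w} → u ≤ m → w ≤ m → pot u ≡ pot w → u ≡ w
  pot-injective {u} {w} u≤m w≤m pu≡pw with u ≟ w
  ... | yes u≡w = u≡w
  ... | no u≢w  = contradiction (trans (cong (_⊕ pot w) pu≡pw) (⊕-self (pot w))) (edge-nonzero u≤m w≤m u≢w)

  edge-cancelˡ : ∀ {u w d} → edge u w ≡ edge u d → pot w ≡ pot d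
  edge-cancelˡ {u} {w} {d} eq =
    trans (sym (⊕-cancelˡ (pot u) (pot w))) (trans (cong (pot u ⊕_) eq) (⊕-cancelˡ (pot u) (pot d)))

  edge-injective : ∀ {u w c d} → u ≤ m → w ≤ m → c ≤ m → d ≤ m → u ≢ w →
                   edge u w ≡ edge c d → (u ≡ c × w ≡ d) ⊎ (u ≡ d × w ≡ c)
  edge-injective {u} {w} {c} {d} u≤m w≤m c≤m d≤m u≢w eq
    with ∂-edge-endpoint c≤m d≤m u≤m (trans (cong (∂ u) (sym eq)) (∂-edge-end u≤m w≤m u≢w))
  ... | inj₁ refl = inj₁ (refl , pot-injective w≤m d≤m (edge-cancelˡ {u} {w} {d} eq))
  ... | inj₂ refl = inj₂ (refl , pot-injective w≤m c≤m (edge-cancelˡ {u} {w} {c} (trans eq (edge-comm c u))))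

  incident : ∀ v (L : List (Z2 m)) → ∂ v (sumZ2 L) ≡ true → ∃[ x ] (x ∈ L × ∂ v x ≡ true)
  incident v []      ∂≡true = contradiction (trans (sym ∂≡true) (∂-𝟎 v)) λ ()
  incident v (x ∷ L) ∂≡true with ∂ v x in ∂x
  ... | true  = x , here refl , ∂x
  ... | false with incident v L (begin
    ∂ v (sumZ2 L)                ≡⟨ cong (_xor ∂ v (sumZ2 L)) (sym ∂x) ⟩
    ∂ v x xor ∂ v (sumZ2 L)      ≡⟨ sym (∂-⊕ v x (sumZ2 L)) ⟩
    ∂ v (x ⊕ sumZ2 L)            ≡⟨ ∂≡true ⟩
    true                         ∎)
    where open ≡-Reasoning
  ...   | y , y∈L , ∂y = y , there y∈L , ∂y

-- A walk is given by its first vertex a and the list vs of the following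
-- vertices; end a vs is its last vertex.

end : ℕ → List ℕ → ℕ
end a []       = a
end a (b ∷ vs) = end b vs

end-∈ : ∀ a vs → end a vs ∈ a ∷ vs
end-∈ a []       = here refl
end-∈ a (b ∷ vs) = there (end-∈ b vs)

end-snoc : ∀ a vs p → end a (vs ++ [ p ]) ≡ p
end-snoc a []       p = refl
end-snoc a (b ∷ vs) p = end-snoc b vs p

consec-∈ : ∀ {vs c d} → Consec vs c d → c ∈ vs × d ∈ vs
consec-∈ here        = here refl , there (here refl)
consec-∈ (there c~d) = let c∈ , d∈ = consec-∈ c~d in there c∈ , there d∈

consec-distinct : ∀ {vs c d} → Unique vs → Consec vs c d → c ≢ d
consec-distinct (c∉ ∷ _)  here        = All.head c∉
consec-distinct (_ ∷ uvs) (there c~d) = consec-distinct uvs c~d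

consec-cover : ∀ {a b vs v} → v ∈ a ∷ b ∷ vs →
               ∃[ w ] (Consec (a ∷ b ∷ vs) v w ⊎ Consec (a ∷ b ∷ vs) w v)
consec-cover {b = b}         (here refl)         = b , inj₁ here
consec-cover {a = a}         (there (here refl)) = a , inj₂ here
consec-cover {vs = c ∷ vs}   (there (there v∈))  with consec-cover {vs = vs} (there v∈)
... | w , inj₁ v~w = w , inj₁ (there v~w)
... | w , inj₂ w~v = w , inj₂ (there w~v)

Unique-⊆ : ∀ {A : Set} {xs ys : List A} → xs ⊆ ys → Unique ys → Unique xs
Unique-⊆ []          []          = []
Unique-⊆ (y ∷ʳ xs⊆ys) (_ ∷ uys)   = Unique-⊆ xs⊆ys uys
Unique-⊆ (refl ∷ xs⊆ys) (y∉ ∷ uys) = All-resp-⊆ xs⊆ys y∉ ∷ Unique-⊆ xs⊆ys uys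

unique-middle : ∀ {A : Set} (xs : List A) {y ys} → Unique (xs ++ y ∷ ys) → y ∉ xs
unique-middle (x ∷ xs) (x∉ ∷ _)   (here refl) = All.lookup x∉ (∈-++⁺ʳ xs (here refl)) refl
unique-middle (x ∷ xs) (_ ∷ uxs)  (there y∈)  = unique-middle xs uxs y∈

module _ {m : ℕ} where

  open DecMembership (_≟ᵥ_ {m}) using (_∈?_)

  Bounded : List ℕ → Set
  Bounded = All (_≤ m)

  EdgeIn : List (Z2 m) → ℕ → ℕ → Set
  EdgeIn E u w = u ≤ m × w ≤ m × u ≢ w × edge u w ∈ E

  pathEdges : ℕ → List ℕ → List (Z2 m)
  pathEdges a []       = []
  pathEdges a (b ∷ vs) = edge a b ∷ pathEdges b vs

  pathEdges-sum : ∀ a vs → sumZ2 (pathEdges a vs) ≡ pot a ⊕ pot (end a vs)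
  pathEdges-sum a []       = sym (⊕-self (pot a))
  pathEdges-sum a (b ∷ vs) = begin
    edge a b ⊕ sumZ2 (pathEdges b vs)      ≡⟨ cong (edge a b ⊕_) (pathEdges-sum b vs) ⟩
    (pot a ⊕ pot b) ⊕ (pot b ⊕ pot (end b vs))  ≡⟨ ⊕-telescope (pot a) (pot b) (pot (end b vs)) ⟩
    pot a ⊕ pot (end b vs)                 ∎
    where open ≡-Reasoning

  pathEdges-split : ∀ a vs p ws → pathEdges a (vs ++ p ∷ ws) ≡ pathEdges a (vs ++ [ p ]) ++ pathEdges p ws
  pathEdges-split a []       p ws = refl
  pathEdges-split a (b ∷ vs) p ws = cong (edge a b ∷_) (pathEdges-split b vs p ws)

  consec-edge : ∀ {a vs c d} → Consec (a ∷ vs) c d → edge c d ∈ pathEdges a vs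
  consec-edge {vs = b ∷ vs} here        = here refl
  consec-edge {vs = b ∷ vs} (there c~d) = there (consec-edge c~d)

  edge∈path : ∀ {a vs z} → z ∈ pathEdges a vs → ∃[ c ] ∃[ d ] (Consec (a ∷ vs) c d × z ≡ edge c d)
  edge∈path {a} {b ∷ vs} (here refl) = a , b , here , refl
  edge∈path {a} {b ∷ vs} (there z∈) with edge∈path z∈
  ... | c , d , c~d , z≡ = c , d , there c~d , z≡

  path-avoids : ∀ {a vs v z} → Bounded (a ∷ vs) → v ≤ m → v ∉ a ∷ vs → z ∈ pathEdges a vs → ∂ v z ≡ false
  path-avoids bounds v≤m v∉ z∈ with edge∈path z∈
  ... | c , d , c~d , refl =
    let c∈ , d∈ = consec-∈ c~d in
    ∂-edge-away (All.lookup bounds c∈) (All.lookup bounds d∈) v≤m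
      (λ c≡v → v∉ (subst (_∈ _) c≡v c∈)) (λ d≡v → v∉ (subst (_∈ _) d≡v d∈))

  pathEdges-unique : ∀ {a vs} → Unique (a ∷ vs) → Bounded (a ∷ vs) → Unique (pathEdges a vs)
  pathEdges-unique {a} {[]}     _           _                 = []
  pathEdges-unique {a} {b ∷ vs} (a∉ ∷ uvs) (a≤m ∷ bounds) =
    All.tabulate new ∷ pathEdges-unique uvs bounds
    where
    new : ∀ {z} → z ∈ pathEdges b vs → edge a b ≢ z
    new z∈ refl = contradiction (path-avoids bounds a≤m (λ a∈ → All.lookup a∉ a∈ refl) z∈)
                    (λ ∂≡false → contradiction (trans (sym (∂-edge-end a≤m (All.head bounds) (All.head a∉))) ∂≡false) λ ())

  path-adjacency : ∀ {a vs u w} → Unique (a ∷ vs) → Bounded (a ∷ vs) →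
                   EdgeIn (pathEdges a vs) u w ⇔ (Consec (a ∷ vs) u w ⊎ Consec (a ∷ vs) w u)
  path-adjacency {a} {vs} {u} {w} uvs bounds = mk⇔ to from
    where
    bound : ∀ {v} → v ∈ a ∷ vs → v ≤ m
    bound = All.lookup bounds
    to : EdgeIn (pathEdges a vs) u w → Consec (a ∷ vs) u w ⊎ Consec (a ∷ vs) w u
    to (u≤m , w≤m , u≢w , uw∈) with edge∈path uw∈
    ... | c , d , c~d , uw≡cd
      with edge-injective u≤m w≤m (bound (proj₁ (consec-∈ c~d))) (bound (proj₂ (consec-∈ c~d))) u≢w uw≡cd
    ...   | inj₁ (refl , refl) = inj₁ c~d
    ...   | inj₂ (refl , refl) = inj₂ c~d
    from : Consec (a ∷ vs) u w ⊎ Consec (a ∷ vs) w u → EdgeIn (pathEdges a vs) u w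
    from (inj₁ u~w) = bound (proj₁ (consec-∈ u~w)) , bound (proj₂ (consec-∈ u~w)) ,
                      consec-distinct uvs u~w , consec-edge u~w
    from (inj₂ w~u) = bound (proj₂ (consec-∈ w~u)) , bound (proj₁ (consec-∈ w~u)) ,
                      consec-distinct uvs w~u ∘ sym , subst (_∈ _) (edge-comm w u) (consec-edge w~u)

  -- no non-empty set of edges of a simple path sums to zero: the edge of the
  -- set nearest to the start a is the only one with boundary at a
  path-reduced : ∀ {a vs} → Unique (a ∷ vs) → Bounded (a ∷ vs) → ∀ {A y} → Unique A →
                 (∀ {z} → z ∈ A → z ∈ pathEdges a vs) → y ∈ A → sumZ2 A ≢ 𝟎
  path-reduced {a} {[]}     _              _              _  inPath y∈A with inPath y∈A
  ... | ()
  path-reduced {a} {b ∷ vs} uvs@(a∉ ∷ ubvs) (a≤m ∷ bounds) {A} uA inPath y∈A with edge a b ∈? A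
  ... | no ab∉A = path-reduced ubvs bounds uA later y∈A
    where
    later : ∀ {z} → z ∈ A → z ∈ pathEdges b vs
    later z∈A with inPath z∈A
    ... | here refl = contradiction z∈A ab∉A
    ... | there z∈  = z∈
  ... | yes ab∈A = λ sumA≡𝟎 →
    let rest≡ab : sumZ2 (remove (edge a b) A) ≡ edge a b
        rest≡ab = sym (⊕≡𝟎⇒≡ _ _ (trans (sym (sum-remove uA ab∈A)) sumA≡𝟎))
        z , z∈rest , ∂z≡true = incident a (remove (edge a b) A)
                                 (trans (cong (∂ a) rest≡ab) (∂-edge-end a≤m (All.head bounds) (All.head a∉)))
        z∈A , z≢ab = ∈-remove⁻ A z∈rest
    in contradiction (trans (sym ∂z≡true) (path-avoids bounds a≤m (Unique[x∷xs]⇒x∉xs uvs) (later z∈A z≢ab))) λ ()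
    where
    later : ∀ {z} → z ∈ A → z ≢ edge a b → z ∈ pathEdges b vs
    later z∈A z≢ab with inPath z∈A
    ... | here z≡ab = contradiction z≡ab z≢ab
    ... | there z∈  = z∈

-- If S consists of edges, is reduced, and sums to the edge pq, then S is
-- the edge set of a simple path from p to q.  By induction on |S|: some
-- edge x = pr of S leaves p; the rest S ∖ {x} sums to the edge rq, so it is
-- a path from r to q (or empty when r = q), and that path cannot pass
-- through p, since the part of it from r to p would close a cycle with x.

module _ {m : ℕ} where

  record ProperPart (B S : List (Z2 m)) : Set where
    field
      unique  : Unique B
      inside  : ∀ {z} → z ∈ B → z ∈ S
      element : ∃ (_∈ B)
      missing : ∃[ z ] (z ∈ S × z ∉ B)

  ReducedSet : List (Z2 m) → Set
  ReducedSet S = ∀ {B} → ProperPart B S → sumZ2 B ≢ 𝟎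

  ReducedSet-⊆ : ∀ {S T : List (Z2 m)} → (∀ {z} → z ∈ T → z ∈ S) → ReducedSet S → ReducedSet T
  ReducedSet-⊆ T⊆S reduced part = reduced record
    { unique  = unique
    ; inside  = T⊆S ∘ inside
    ; element = element
    ; missing = let z , z∈T , z∉B = missing in z , T⊆S z∈T , z∉B }
    where open ProperPart part

  IsEdge : Z2 m → Set
  IsEdge x = ∃[ u ] ∃[ w ] (u ≤ m × w ≤ m × u ≢ w × x ≡ edge u w)

  record PathFrom (S : List (Z2 m)) (p q : ℕ) : Set where
    constructor mkPath
    field
      route   : List ℕ
      simple  : Unique (p ∷ route)
      bounded : Bounded {m} (p ∷ route)
      ends    : end p route ≡ q
      edges   : S ∼[ set ] pathEdges p route

  trivial-path : ∀ {S q} → (∀ {z} → z ∉ S) → q ≤ m → PathFrom S q q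
  trivial-path empty q≤m = record
    { route = [] ; simple = [] ∷ [] ; bounded = q≤m ∷ [] ; ends = refl
    ; edges = mk⇔ (⊥-elim ∘ empty) λ () }

  extend : ∀ {S x p r q} → x ∈ S → x ≡ edge p r → p ≤ m → (path : PathFrom (remove x S) r q) →
           p ∉ r ∷ PathFrom.route path → PathFrom S p q
  extend {S} {x} {p} {r} x∈S refl p≤m path p∉ = record
    { route   = r ∷ route
    ; simple  = All.tabulate (λ v∈ p≡v → p∉ (subst (_∈ _) (sym p≡v) v∈)) ∷ simple
    ; bounded = p≤m ∷ bounded
    ; ends    = ends
    ; edges   = mk⇔ into back }
    where
    open PathFrom path
    into : ∀ {z} → z ∈ S → z ∈ pathEdges p (r ∷ route)
    into {z} z∈S with z ≟ᵥ x
    ... | yes refl = here refl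
    ... | no z≢x   = there (Equivalence.to edges (∈-remove⁺ z∈S z≢x))
    back : ∀ {z} → z ∈ pathEdges p (r ∷ route) → z ∈ S
    back (here refl) = x∈S
    back (there z∈)  = proj₁ (∈-remove⁻ S (Equivalence.from edges z∈))

  -- a path r ⇝ q for S ∖ {x}, x = pr, cannot pass through p ≠ q: its part from
  -- r to p together with x would be a proper part of S with sum zero
  no-return : ∀ {S x p r q} → ReducedSet S → x ∈ S → x ≡ edge p r → p ≢ q →
              (path : PathFrom (remove x S) r q) → p ∉ PathFrom.route path
  no-return {S} {x} {p} {r} {q} reduced x∈S x≡pr p≢q path p∈route =
    let ys , zs , route≡ = ∈-∃++ p∈route in close ys zs route≡
    where
    open PathFrom path
    inRest : ∀ {z} → z ∈ pathEdges r route → z ∈ S × z ≢ x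
    inRest z∈ = ∈-remove⁻ S (Equivalence.from edges z∈)
    close : ∀ ys zs → route ≡ ys ++ p ∷ zs → ⊥
    close ys []       route≡ = p≢q (trans (sym (end-snoc r ys p)) (trans (cong (end r) (sym route≡)) ends))
    close ys (t ∷ ws) route≡ = reduced part sum≡𝟎
      where
      cycle : List (Z2 m)
      cycle = pathEdges r (ys ++ [ p ])
      all≡ : pathEdges r route ≡ cycle ++ edge p t ∷ pathEdges t ws
      all≡ = trans (cong (pathEdges r) route≡) (pathEdges-split r ys p (t ∷ ws))
      unique-all : Unique (cycle ++ edge p t ∷ pathEdges t ws)
      unique-all = subst Unique all≡ (pathEdges-unique simple bounded)
      inCycle : ∀ {z} → z ∈ cycle → z ∈ S × z ≢ x
      inCycle z∈ = inRest (subst (_ ∈_) (sym all≡) (Any-resp-⊆ (++⁺ʳ _ ⊆-refl) z∈))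
      pt∈ : edge p t ∈ pathEdges r route
      pt∈ = subst (_ ∈_) (sym all≡) (∈-++⁺ʳ cycle (here refl))
      part : ProperPart (x ∷ cycle) S
      part = record
        { unique  = All.tabulate (λ z∈ x≡z → proj₂ (inCycle z∈) (sym x≡z))
                    ∷ Unique-⊆ (++⁺ʳ _ ⊆-refl) unique-all
        ; inside  = λ { (here refl) → x∈S ; (there z∈) → proj₁ (inCycle z∈) }
        ; element = x , here refl
        ; missing = edge p t , proj₁ (inRest pt∈) ,
                    λ { (here pt≡x) → proj₂ (inRest pt∈) pt≡x
                      ; (there pt∈cycle) → unique-middle cycle unique-all pt∈cycle } }
      sum≡𝟎 : sumZ2 (x ∷ cycle) ≡ 𝟎
      sum≡𝟎 = begin
        x ⊕ sumZ2 cycle                    ≡⟨ cong₂ _⊕_ x≡pr (pathEdges-sum r (ys ++ [ p ])) ⟩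
        edge p r ⊕ (pot r ⊕ pot (end r (ys ++ [ p ])))  ≡⟨ cong (λ v → edge p r ⊕ (pot r ⊕ pot v)) (end-snoc r ys p) ⟩
        edge p r ⊕ edge r p                ≡⟨ cong (edge p r ⊕_) (edge-comm r p) ⟩
        edge p r ⊕ edge p r                ≡⟨ ⊕-self (edge p r) ⟩
        𝟎                                  ∎
        where open ≡-Reasoning

  first-edge : ∀ {S p q} → All IsEdge S → p ≤ m → q ≤ m → p ≢ q → sumZ2 S ≡ edge p q →
               ∃[ x ] ∃[ r ] (x ∈ S × x ≡ edge p r × r ≤ m × p ≢ r)
  first-edge {S} {p} allEdges p≤m q≤m p≢q sumS
    with incident p S (trans (cong (∂ p) sumS) (∂-edge-end p≤m q≤m p≢q))
  ... | x , x∈S , ∂x with All.lookup allEdges x∈S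
  ...   | u , w , u≤m , w≤m , u≢w , refl with ∂-edge-endpoint u≤m w≤m p≤m ∂x
  ...     | inj₁ refl = x , w , x∈S , refl , w≤m , u≢w
  ...     | inj₂ refl = x , u , x∈S , edge-comm u w , u≤m , u≢w ∘ sym

  remove-shorter : ∀ {x} {S : List (Z2 m)} → x ∈ S → length (remove x S) < length S
  remove-shorter {x} {S} x∈S =
    filter-notAll (λ y → ¬? (y ≟ᵥ x)) S (Any.map (λ x≡y y≢x → y≢x (sym x≡y)) x∈S)

  remove-sum : ∀ {S : List (Z2 m)} {x p q r} → Unique S → x ∈ S → x ≡ edge p r → sumZ2 S ≡ edge p q →
               sumZ2 (remove x S) ≡ edge r q
  remove-sum {S} {x} {p} {q} {r} uS x∈S x≡pr sumS = begin
    sumZ2 (remove x S)                 ≡⟨ sym (⊕-cancelˡ x (sumZ2 (remove x S))) ⟩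
    x ⊕ (x ⊕ sumZ2 (remove x S))       ≡⟨ cong (x ⊕_) (sym (sum-remove uS x∈S)) ⟩
    x ⊕ sumZ2 S                        ≡⟨ cong₂ _⊕_ (trans x≡pr (edge-comm p r)) sumS ⟩
    edge r p ⊕ edge p q                ≡⟨ ⊕-telescope (pot r) (pot p) (pot q) ⟩
    edge r q                           ∎
    where open ≡-Reasoning

  remove-empty : ∀ {S : List (Z2 m)} {x} → Unique S → ReducedSet S → x ∈ S → sumZ2 (remove x S) ≡ 𝟎 →
                 ∀ {z} → z ∉ remove x S
  remove-empty {S} {x} uS reduced x∈S sum≡𝟎 z∈rest = reduced part sum≡𝟎
    where
    part : ProperPart (remove x S) S
    part = record
      { unique  = remove-unique uS
      ; inside  = proj₁ ∘ ∈-remove⁻ S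
      ; element = _ , z∈rest
      ; missing = x , x∈S , λ x∈rest → proj₂ (∈-remove⁻ S x∈rest) refl }

  reconstruct : ∀ {p q} S → Acc (_<_ on length) S → Unique S → All IsEdge S → ReducedSet S →
                p ≤ m → q ≤ m → p ≢ q → sumZ2 S ≡ edge p q → PathFrom S p q
  reconstruct {p} {q} S (acc shorter) uS allEdges reduced p≤m q≤m p≢q sumS =
    continue (first-edge {S} {p} {q} allEdges p≤m q≤m p≢q sumS)
    where
    continue : ∃[ x ] ∃[ r ] (x ∈ S × x ≡ edge p r × r ≤ m × p ≢ r) → PathFrom S p q
    continue (x , r , x∈S , x≡pr , r≤m , p≢r) = extend {S} {x} {p} {r} {q} x∈S x≡pr p≤m rest p∉
      where
      rest⊆S : ∀ {z} → z ∈ remove x S → z ∈ S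
      rest⊆S = proj₁ ∘ ∈-remove⁻ S
      sum-rest : sumZ2 (remove x S) ≡ edge r q
      sum-rest = remove-sum {S} {x} {p} {q} {r} uS x∈S x≡pr sumS
      rest : PathFrom (remove x S) r q
      rest with r ≟ q
      ... | yes refl = trivial-path (remove-empty uS reduced x∈S (trans sum-rest (⊕-self (pot r)))) r≤m
      ... | no r≢q   = reconstruct (remove x S) (shorter (remove-shorter x∈S)) (remove-unique uS)
                         (All.tabulate (All.lookup allEdges ∘ rest⊆S)) (ReducedSet-⊆ rest⊆S reduced)
                         r≤m q≤m r≢q sum-rest
      p∉ : p ∉ r ∷ PathFrom.route rest
      p∉ (here p≡r)      = p≢r p≡r
      p∉ (there p∈route) = no-return {S} {x} {p} {r} {q} reduced x∈S x≡pr p≢q rest p∈route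

-- With n = m + 1 vertices, the block of 1's from coordinate i to j
-- (1-indexed) is the edge joining n-i and n-j-1, i.e. pot (n-i) ⊕ pot (n-j-1).

zipWith-tabulate : ∀ {A B C : Set} {k} (f : A → B → C) (g : Fin k → A) (h : Fin k → B) →
                   zipWith f (tabulate g) (tabulate h) ≡ tabulate (λ i → f (g i) (h i))
zipWith-tabulate {k = zero}  f g h = refl
zipWith-tabulate {k = suc k} f g h = cong (f (g fzero) (h fzero) ∷_) (zipWith-tabulate f (g ∘ fsuc) (h ∘ fsuc))

block-steps : ∀ {m} i j → i ≤ j → block m (suc i) j ≡ step i ⊕ step j
block-steps {m} i j i≤j = trans (tabulate-cong pointwise) (sym (zipWith-tabulate _xor_ _ _))
  where
  pointwise : ∀ (k : Fin m) → (suc i ≤ᵇ suc (toℕ k)) ∧ (suc (toℕ k) ≤ᵇ j) ≡ (i ≤ᵇ toℕ k) xor (j ≤ᵇ toℕ k)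
  pointwise k rewrite suc-≤ᵇ i (toℕ k) with j ≤? toℕ k
  ... | yes j≤k rewrite ≤ᵇ-true (≤-trans i≤j j≤k) | ≤ᵇ-true j≤k | ≤ᵇ-false (<⇒≱ (s≤s j≤k)) = refl
  ... | no j≰k  rewrite ≤ᵇ-false j≰k | ≤ᵇ-true (≰⇒> j≰k) =
    trans (∧-identityʳ (i ≤ᵇ toℕ k)) (sym (xor-identityʳ (i ≤ᵇ toℕ k)))

suc-∸-∸1 : ∀ m j → suc m ∸ j ∸ 1 ≡ m ∸ j
suc-∸-∸1 m j = trans (∸-+-assoc (suc m) j 1) (cong (suc m ∸_) (+-comm j 1))

module _ {m : ℕ} where

  block-edge : ∀ {i j} → 1 ≤ i → i ≤ j → j ≤ m → block m i j ≡ edge (suc m ∸ i) (m ∸ j)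
  block-edge {suc i} {j} _ i<j j≤m = begin
    block m (suc i) j                       ≡⟨ block-steps i j (<⇒≤ i<j) ⟩
    step i ⊕ step j                         ≡⟨ sym (cong₂ (λ a b → step a ⊕ step b) (m∸[m∸n]≡n i≤m) (m∸[m∸n]≡n j≤m)) ⟩
    step (m ∸ (m ∸ i)) ⊕ step (m ∸ (m ∸ j)) ≡⟨⟩
    edge (m ∸ i) (m ∸ j)                    ∎
    where
    open ≡-Reasoning
    i≤m : i ≤ m
    i≤m = ≤-trans (<⇒≤ i<j) j≤m

  edge-block : ∀ {u w} → w < u → u ≤ m →
               1 ≤ suc m ∸ u × suc m ∸ u ≤ m ∸ w × block m (suc m ∸ u) (m ∸ w) ≡ edge u w
  edge-block {u} {w} w<u u≤m rewrite +-∸-assoc 1 u≤m =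
    s≤s z≤n , ∸-monoʳ-< w<u u≤m ,
    trans (block-edge (s≤s z≤n) (∸-monoʳ-< w<u u≤m) (m∸n≤m m w))
          (cong₂ edge (m∸[m∸n]≡n u≤m) (m∸[m∸n]≡n (≤-trans (<⇒≤ w<u) u≤m)))

  code-edge : (G : SimpleGraph (suc m)) → ∀ {x} → InBeta G x → IsEdge x
  code-edge G (I , J , J<I , _ , refl) =
    toℕ I , toℕ J , I≤m , ≤-trans (<⇒≤ J<I) I≤m , <⇒≢ J<I ∘ sym ,
    trans (cong (block m (suc m ∸ toℕ I)) (suc-∸-∸1 m (toℕ J))) (proj₂ (proj₂ (edge-block J<I I≤m)))
    where
    I≤m : toℕ I ≤ m
    I≤m = ≤-pred (toℕ<n I)

  EdgeIn-sym : ∀ {E : List (Z2 m)} {u w} → EdgeIn E u w → EdgeIn E w u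
  EdgeIn-sym {E} {u} {w} (u≤m , w≤m , u≢w , uw∈) = w≤m , u≤m , u≢w ∘ sym , subst (_∈ E) (edge-comm u w) uw∈

  GSAdj⇔EdgeIn : ∀ S u w → GSAdj (suc m) S u w ⇔ EdgeIn S u w
  GSAdj⇔EdgeIn S u w = mk⇔ to from
    where
    oriented : ∀ {i j} → 1 ≤ i → i ≤ j → j ≤ m → block m i j ∈ S → EdgeIn S (suc m ∸ i) (suc m ∸ j ∸ 1)
    oriented {suc i} {j} 1≤i i<j j≤m block∈ rewrite suc-∸-∸1 m j =
      m∸n≤m m i , m∸n≤m m j , <⇒≢ (∸-monoʳ-< i<j j≤m) ∘ sym , subst (_∈ S) (block-edge 1≤i i<j j≤m) block∈
    to : GSAdj (suc m) S u w → EdgeIn S u w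
    to (i , j , 1≤i , i≤j , j≤m , block∈ , inj₁ (refl , refl)) = oriented 1≤i i≤j j≤m block∈
    to (i , j , 1≤i , i≤j , j≤m , block∈ , inj₂ (refl , refl)) = EdgeIn-sym (oriented 1≤i i≤j j≤m block∈)
    realise : ∀ {u w} → w < u → EdgeIn S u w → GSAdj (suc m) S u w
    realise {u} {w} w<u (u≤m , w≤m , _ , uw∈) =
      let 1≤i , i≤j , block≡ = edge-block w<u u≤m in
      suc m ∸ u , m ∸ w , 1≤i , i≤j , m∸n≤m m w , subst (_∈ S) (sym block≡) uw∈ ,
      inj₁ (sym (m∸[m∸n]≡n (≤-trans u≤m (n≤1+n m))) , sym (trans (suc-∸-∸1 m (m ∸ w)) (m∸[m∸n]≡n w≤m)))
    reverse : ∀ {u w} → GSAdj (suc m) S w u → GSAdj (suc m) S u w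
    reverse (i , j , 1≤i , i≤j , j≤m , block∈ , ends) = i , j , 1≤i , i≤j , j≤m , block∈ , ⊎-swap ends
    from : EdgeIn S u w → GSAdj (suc m) S u w
    from uw@(_ , _ , u≢w , _) with <-cmp w u
    ... | tri< w<u _ _ = realise w<u uw
    ... | tri≈ _ w≡u _ = contradiction (sym w≡u) u≢w
    ... | tri> _ _ u<w = reverse (realise u<w (EdgeIn-sym uw))

module _ {m : ℕ} where

  open DecMembership (_≟ᵥ_ {m}) using (_∈?_)

  edge-InC : ∀ {u w} → u ≤ m → w ≤ m → u ≢ w → InC (edge {m} u w)
  edge-InC {u} {w} u≤m w≤m u≢w =
    steps⇒InC (m ∸ u) (m ∸ w) (m∸n≤m m u) (m∸n≤m m w) (edge-nonzero u≤m w≤m u≢w)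

  InC-edge : ∀ {x : Z2 m} → InC x → ∃[ p ] ∃[ q ] (p ≤ m × q ≤ m × p ≢ q × x ≡ edge p q)
  InC-edge {x} inC =
    let c , d , c<d , d≤m , x≡ = InC⇒steps inC
        c≤m = ≤-trans (<⇒≤ c<d) d≤m
    in m ∸ c , m ∸ d , m∸n≤m m c , m∸n≤m m d , <⇒≢ c<d ∘ ∸-cancelˡ-≡ c≤m d≤m ,
       trans x≡ (sym (cong₂ (λ a b → step a ⊕ step b) (m∸[m∸n]≡n c≤m) (m∸[m∸n]≡n d≤m)))

  Reduced⇒ReducedSet : ∀ {S : List (Z2 m)} → Unique S → Reduced S → ReducedSet S
  Reduced⇒ReducedSet {S} uS (_ , reduced) {B} part sumB≡𝟎 =
    reduced A (filter-⊆ inB? S) A≢[] (filter-notAll inB? S outside) (trans sumA≡sumB sumB≡𝟎)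
    where
    open ProperPart part
    inB? : ∀ z → Dec (z ∈ B)
    inB? z = z ∈? B
    A : List (Z2 m)
    A = filter inB? S
    A≢[] : A ≢ []
    A≢[] A≡[] with subst (proj₁ element ∈_) A≡[] (∈-filter⁺ inB? (inside (proj₂ element)) (proj₂ element))
    ... | ()
    outside : Any (λ y → ¬ y ∈ B) S
    outside = let z , z∈S , z∉B = missing in Any.map (λ z≡y y∈B → z∉B (subst (_∈ B) (sym z≡y) y∈B)) z∈S
    sumA≡sumB : sumZ2 A ≡ sumZ2 B
    sumA≡sumB = sum-set (filter⁺ inB? uS) unique
                  (mk⇔ (proj₂ ∘ ∈-filter⁻ inB? {xs = S}) (λ z∈B → ∈-filter⁺ inB? (inside z∈B) z∈B))

  EdgeIn-cong : ∀ {S T : List (Z2 m)} {u w} → S ∼[ set ] T → EdgeIn S u w ⇔ EdgeIn T u w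
  EdgeIn-cong S≈T = mk⇔ (λ (u≤m , w≤m , u≢w , uw∈) → u≤m , w≤m , u≢w , Equivalence.to S≈T uw∈)
                         (λ (u≤m , w≤m , u≢w , uw∈) → u≤m , w≤m , u≢w , Equivalence.from S≈T uw∈)

  EdgeIn-transfer : ∀ {S T : List (Z2 m)} → (∀ {z} → z ∈ S → IsEdge z) →
                    (∀ u w → EdgeIn S u w → EdgeIn T u w) → ∀ {z} → z ∈ S → z ∈ T
  EdgeIn-transfer isEdge transfer z∈S =
    let u , w , u≤m , w≤m , u≢w , z≡uw = isEdge z∈S
    in subst (_∈ _) (sym z≡uw) (proj₂ (proj₂ (proj₂ (transfer u w (u≤m , w≤m , u≢w , subst (_∈ _) z≡uw z∈S)))))

  same-edges : ∀ {S T : List (Z2 m)} → (∀ {z} → z ∈ S → IsEdge z) → (∀ {z} → z ∈ T → IsEdge z) →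
               (∀ u w → EdgeIn S u w ⇔ EdgeIn T u w) → S ∼[ set ] T
  same-edges edgeS edgeT same =
    mk⇔ (EdgeIn-transfer edgeS (λ u w → Equivalence.to (same u w)))
        (EdgeIn-transfer edgeT (λ u w → Equivalence.from (same u w)))

  pathEdges-IsEdge : ∀ {a vs} {z : Z2 m} → Unique (a ∷ vs) → Bounded (a ∷ vs) → z ∈ pathEdges a vs → IsEdge z
  pathEdges-IsEdge simple bounds z∈ =
    let c , d , c~d , z≡cd = edge∈path z∈
        c∈ , d∈ = consec-∈ c~d
    in c , d , All.lookup bounds c∈ , All.lookup bounds d∈ , consec-distinct simple c~d , z≡cd

  path⇒conditions : ∀ {S : List (Z2 m)} → Unique S → All IsEdge S → IsPathGS (suc m) S →
                    InC (sumZ2 S) × Reduced S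
  path⇒conditions _  _        ([] , () , _)
  path⇒conditions _  _        (_ ∷ [] , s≤s () , _)
  path⇒conditions {S} uS allEdges (a ∷ b ∷ vs , _ , simple , adjacency) =
    subst InC (sym sum≡) (edge-InC (All.head bounds) (All.lookup bounds (there (end-∈ b vs))) a≢end) ,
    nonempty , reduced
    where
    adjacencyS : ∀ u w → EdgeIn S u w ⇔ (Consec (a ∷ b ∷ vs) u w ⊎ Consec (a ∷ b ∷ vs) w u)
    adjacencyS u w = ⇔-trans (⇔-sym (GSAdj⇔EdgeIn S u w)) (adjacency u w)
    bounds : Bounded (a ∷ b ∷ vs)
    bounds = All.tabulate λ v∈ → let w , neighbours = consec-cover v∈ in
                                 proj₁ (Equivalence.from (adjacencyS _ w) neighbours)
    edges : S ∼[ set ] pathEdges a (b ∷ vs)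
    edges = same-edges (All.lookup allEdges) (pathEdges-IsEdge simple bounds)
              λ u w → ⇔-trans (adjacencyS u w) (⇔-sym (path-adjacency simple bounds))
    sum≡ : sumZ2 S ≡ edge a (end b vs)
    sum≡ = trans (sum-set uS (pathEdges-unique simple bounds) edges) (pathEdges-sum a (b ∷ vs))
    a≢end : a ≢ end b vs
    a≢end a≡end = Unique[x∷xs]⇒x∉xs simple (subst (_∈ b ∷ vs) (sym a≡end) (end-∈ b vs))
    nonempty : S ≢ []
    nonempty S≡[] with subst (edge a b ∈_) S≡[] (Equivalence.from edges (here refl))
    ... | ()
    reduced : ∀ A → A ⊆ S → A ≢ [] → length A < length S → sumZ2 A ≢ 𝟎
    reduced []      _   A≢[] _ = contradiction refl A≢[]
    reduced (y ∷ A) A⊆S _    _ = path-reduced simple bounds (Unique-⊆ A⊆S uS)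
                                   (Equivalence.to edges ∘ Any-resp-⊆ A⊆S) (here refl)

  PathFrom⇒IsPathGS : ∀ {S : List (Z2 m)} {p q} → p ≢ q → PathFrom S p q → IsPathGS (suc m) S
  PathFrom⇒IsPathGS p≢q (mkPath []       _      _       p≡q _)     = contradiction p≡q p≢q
  PathFrom⇒IsPathGS {S} {p} p≢q (mkPath (t ∷ ts) simple bounded _ edges) =
    p ∷ t ∷ ts , s≤s (s≤s z≤n) , simple ,
    λ u w → ⇔-trans (GSAdj⇔EdgeIn S u w) (⇔-trans (EdgeIn-cong edges) (path-adjacency simple bounded))

  conditions⇒path : ∀ {S : List (Z2 m)} → Unique S → All IsEdge S → InC (sumZ2 S) × Reduced S →
                    IsPathGS (suc m) S
  conditions⇒path {S} uS allEdges (inC , reduced) =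
    let p , q , p≤m , q≤m , p≢q , sum≡ = InC-edge inC
    in PathFrom⇒IsPathGS p≢q
         (reconstruct S (On.wellFounded length <-wellFounded S) uS allEdges
           (Reduced⇒ReducedSet uS reduced) p≤m q≤m p≢q sum≡)

no-edgeless-path : ∀ {n} → ¬ IsPathGS n []
no-edgeless-path ([] , () , _)
no-edgeless-path (_ ∷ [] , s≤s () , _)
no-edgeless-path (a ∷ b ∷ _ , _ , _ , adjacency) with Equivalence.from (adjacency a b) (inj₁ here)
... | _ , _ , _ , _ , _ , () , _

-- the theorem: for codes S of edges of G, G̃(S) is a path iff ΣS ∈ C(n-1)
-- and S is reduced (for n = 0 there are no vertices, hence no edges)
lemma4 : (n : ℕ) (G : SimpleGraph n) (S : List (Z2 (pred n))) →
    Unique S → All (InBeta G) S →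
    IsPathGS n S ⇔ (InC (sumZ2 S) × Reduced S)
lemma4 zero    G []      _  _ = mk⇔ (⊥-elim ∘ no-edgeless-path) λ (_ , nonempty , _) → contradiction refl nonempty
lemma4 zero    G (_ ∷ _) _  ((() , _) ∷ _)
lemma4 (suc m) G S       uS inBeta = mk⇔ (path⇒conditions uS allEdges) (conditions⇒path uS allEdges)
  where
  allEdges : All IsEdge S
  allEdges = All.map (code-edge G) inBeta
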